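{- The inference rule $+\partial_{||}^*$ is consistent: for every propositional defeasible theory $D$ and every proposition $q$, if both $+\partial_{||}^* q$ and $+\partial_{||}^* \neg q$ are consequences of $D$, then both $+\Delta q$ and $+\Delta \neg q$ are consequences of $D$.
   Context: Literals are propositions or their negations; ${\sim}q$ is the complement of $q$. A propositional defeasible theory is $D=(F,R,>)$: $F$ finite set of literals, $R$ finite set of rules, $>$ acyclic binary relation on $R$. Each rule has a finite antecedent set $A(r)$ and consequent literal and is strict ($\rightarrow$), defeasible ($\Rightarrow$) or a defeater ($\leadsto$). $R_s$: strict rules; $R_{sd}$: strict and defeasible rules; $R[q]$: rules with consequent $q$. A proof $P$ is a sequence of tagged literals, $P(1..i)$ its first $i$ elements; a conclusion is a consequence if it occurs in some proof. $+\Delta$: append $+\Delta q$ if $q\in F$ or some $r\in R_s[q]$ has $+\Delta a\in P(1..i)$ for all $a\in A(r)$. $-\Delta$: append $-\Delta q$ if $q\notin F$ and every $r\in R_s[q]$ has some $a\in A(r)$ with $-\Delta a\in P(1..i)$. $P_\Delta$: all $\pm\Delta$ conclusions derivable. $+\lambda$: append $+\lambda q$ if $+\Delta q\in P_\Delta$, or some $r\in R_{sd}[q]$ has $+\lambda a\in P(1..i)$ for all $a\in A(r)$ and $+\Delta{\sim}q\notin P_\Delta$. $P_\lambda$: all $+\lambda$ conclusions derivable. $+\partial_{||}^*$: append $+\partial_{||}^*q$ if (1) $+\Delta q\in P_\Delta$, or (2): (2.1) some $r\in R_{sd}[q]$ has $+\partial_{||}^*a\in P(1..i)$ for all $a\in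 A(r)$; (2.2) $+\Delta{\sim}q\notin P_\Delta$; (2.3) every $s\in R[{\sim}q]$ satisfies (2.3.1) some $a\in A(s)$ has $+\lambda a\notin P_\lambda$, or (2.3.2) $r>s$. -}

module Defs where

open import Data.Bool using (Bool; true; false; not)
open import Data.Nat using (ℕ)
open import Data.Fin using (Fin)
open import Data.List using (List; []; _∷_; [_]; _++_)
open import Data.List.Membership.Propositional using (_∈_; _∉_)
open import Data.List.Relation.Unary.All using (All)
open import Data.List.Relation.Unary.Any using (Any)
open import Data.Product using (Σ; _×_; ∃)
open import Data.Sum using (_⊎_)
open import Data.Empty using (⊥)
open import Relation.Nullary using (¬_)
open import Relation.Binary.PropositionalEquality using (_≡_)
open import Relation.Binary.Construct.Closure.Transitive using (TransClosure)

-- A literal over a set of propositions (atoms): an atom with a polarity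
-- (true = positive literal p, false = negated literal ¬p).
record Literal (Atom : Set) : Set where
  constructor lit
  field
    pos  : Bool
    atom : Atom

open Literal public

⁺ : {Atom : Set} → Atom → Literal Atom
⁺ q = lit true q

⁻ : {Atom : Set} → Atom → Literal Atom
⁻ q = lit false q

∼ : {Atom : Set} → Literal Atom → Literal Atom
∼ (lit b p) = lit (not b) p

data Kind : Set where
  strict defeasible defeater : Kind

record Rule (Atom : Set) : Set where
  constructor rule
  field
    kind : Kind
    ante : List (Literal Atom)
    cons : Literal Atom

open Rule public

-- A defeasible theory D = (F, R, >): rules are indexed by Fin n (so that
-- distinct rules with equal content are distinguished), > is a binary
-- relation on rules that is acyclic (its transitive closure is irreflexive).
record Theory (Atom : Set) : Set₁ where
  field
    F       : List (Literal Atom)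
    n       : ℕ
    R       : Fin n → Rule Atom
    _≻_     : Fin n → Fin n → Set
    acyclic : ∀ i → ¬ TransClosure _≻_ i i

open Theory public

data Tag : Set where
  +Δ -Δ +λ +∂ : Tag

record Tagged (Atom : Set) : Set where
  constructor _∶_
  field
    tag : Tag
    lt  : Literal Atom

IsStrict : Kind → Set
IsStrict k = k ≡ strict

IsSD : Kind → Set
IsSD k = k ≡ strict ⊎ k ≡ defeasible

data IsProof {Atom : Set}
             (V : List (Tagged Atom) → Tagged Atom → Set)
           : List (Tagged Atom) → Set where
  []  : IsProof V []
  snoc : ∀ {P t} → IsProof V P → V P t → IsProof V (P ++ [ t ])

module _ {Atom : Set} (D : Theory Atom) where

  ValidΔ : List (Tagged Atom) → Tagged Atom → Set
  ValidΔ P (+Δ ∶ q) =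
    q ∈ F D ⊎
    Σ (Fin (n D)) λ r → IsStrict (kind (R D r)) × cons (R D r) ≡ q ×
                        All (λ a → (+Δ ∶ a) ∈ P) (ante (R D r))
  ValidΔ P (-Δ ∶ q) =
    q ∉ F D ×
    (∀ r → IsStrict (kind (R D r)) → cons (R D r) ≡ q →
           Any (λ a → (-Δ ∶ a) ∈ P) (ante (R D r)))
  ValidΔ P (+λ ∶ q) = ⊥
  ValidΔ P (+∂ ∶ q) = ⊥

  PΔ : Tagged Atom → Set
  PΔ t = ∃ λ P → IsProof ValidΔ P × t ∈ P

  Validλ : List (Tagged Atom) → Tagged Atom → Set
  Validλ P (+λ ∶ q) =
    PΔ (+Δ ∶ q) ⊎
    (Σ (Fin (n D)) λ r → IsSD (kind (R D r)) × cons (R D r) ≡ q ×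
                         All (λ a → (+λ ∶ a) ∈ P) (ante (R D r)) ×
                         ¬ PΔ (+Δ ∶ ∼ q))
  Validλ P t = ValidΔ P t

  Pλ : Tagged Atom → Set
  Pλ t = ∃ λ P → IsProof Validλ P × t ∈ P

  Valid∂ : List (Tagged Atom) → Tagged Atom → Set
  Valid∂ P (+∂ ∶ q) =
    PΔ (+Δ ∶ q) ⊎
    (Σ (Fin (n D)) λ r → IsSD (kind (R D r)) × cons (R D r) ≡ q ×
       All (λ a → (+∂ ∶ a) ∈ P) (ante (R D r)) ×
       ¬ PΔ (+Δ ∶ ∼ q) ×
       (∀ s → cons (R D s) ≡ ∼ q →
          Any (λ a → ¬ Pλ (+λ ∶ a)) (ante (R D s)) ⊎ (_≻_ D r s)))
  Valid∂ P t = Validλ P t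

  Consequence : Tagged Atom → Set
  Consequence t = ∃ λ P → IsProof Valid∂ P × t ∈ P

module Submission where

-- Every element of a proof is justified by its condition with respect to a
-- prefix which is itself a proof (`justified`).  The justification of +∂ l is
-- either (1) +Δ l ∈ P_Δ, or (2) a supporting rule r for l together with
-- +Δ ∼l ∉ P_Δ.  Mixing (1) for one literal with (2) for its complement
-- contradicts (2.2).  Two supports r for l and s for ∼l are impossible:
-- the antecedents of s are +∂-provable, hence +λ-provable (`∂⇒λ`, obtained
-- by replaying a ∂-proof as a λ-proof), so (2.3.1) cannot discount s and
-- r > s must hold (`mustBeat`); symmetrically s > r, contradicting
-- acyclicity of >.  Hence both literals are justified by (1), and the
-- Δ-proofs witnessing them are also ∂-proofs (`Δ⇒consequence`).

open import Defs
open import Data.Fin using (Fin)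
open import Data.Bool.Properties using (not-involutive)
open import Data.Product using (_×_; _,_; Σ; ∃; map)
open import Data.Sum using (_⊎_; inj₁; inj₂)
open import Data.Empty using (⊥; ⊥-elim)
open import Data.List using (List; []; [_]; _++_)
open import Data.List.Membership.Propositional using (_∈_)
open import Data.List.Membership.Propositional.Properties using (∈-++⁻; ∈-++⁺ˡ; ∈-++⁺ʳ)
open import Data.List.Relation.Unary.Any using (Any; here)
open import Data.List.Relation.Unary.All as All using (All)
open import Relation.Nullary using (¬_)
open import Relation.Binary.PropositionalEquality using (_≡_; _≢_; refl; cong; sym; trans; subst)
open import Relation.Binary.Construct.Closure.Transitive as TC using ()

∼-involutive : ∀ {Atom : Set} (l : Literal Atom) → ∼ (∼ l) ≡ l
∼-involutive (lit b p) = cong (λ c → lit c p) (not-involutive b)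

justified : ∀ {Atom : Set} {V : List (Tagged Atom) → Tagged Atom → Set} {P t} →
            IsProof V P → t ∈ P → ∃ λ Q → IsProof V Q × V Q t
justified (snoc {P} pr v) t∈ with ∈-++⁻ P t∈
... | inj₁ t∈P = justified pr t∈P
... | inj₂ (here refl) = P , pr , v

module _ {Atom : Set} (D : Theory Atom) where

  -- The ±Δ conditions are unchanged inside +∂-proofs, so Δ-proofs are
  -- ∂-proofs and every member of P_Δ is a consequence of D.
  Δ⇒∂-step : ∀ {P t} → ValidΔ D P t → Valid∂ D P t
  Δ⇒∂-step {t = +Δ ∶ _} v = v
  Δ⇒∂-step {t = -Δ ∶ _} v = v

  Δ⇒∂-proof : ∀ {P} → IsProof (ValidΔ D) P → IsProof (Valid∂ D) P
  Δ⇒∂-proof [] = []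
  Δ⇒∂-proof (snoc pr v) = snoc (Δ⇒∂-proof pr) (Δ⇒∂-step v)

  Δ⇒consequence : ∀ {t} → PΔ D t → Consequence D t
  Δ⇒consequence (P , pr , t∈) = P , Δ⇒∂-proof pr , t∈

  LambdaShadow : List (Tagged Atom) → Set
  LambdaShadow P = Σ (List (Tagged Atom)) λ P' →
    IsProof (Validλ D) P' × (∀ {a} → (+∂ ∶ a) ∈ P → (+λ ∶ a) ∈ P')

  -- A +∂ step is a +λ step with the extra condition (2.3) dropped, so it can
  -- be replayed on the shadow.
  shadow-∂ : ∀ {P b} → LambdaShadow P → Valid∂ D P (+∂ ∶ b) →
             LambdaShadow (P ++ [ +∂ ∶ b ])
  shadow-∂ {P} {b} (P' , pr' , embed) v = P' ++ [ +λ ∶ b ] , snoc pr' (replay v) , embed'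
    where
    replay : Valid∂ D P (+∂ ∶ b) → Validλ D P' (+λ ∶ b)
    replay (inj₁ strictly) = inj₁ strictly
    replay (inj₂ (r , sd , c , body , noΔ , _)) = inj₂ (r , sd , c , All.map embed body , noΔ)

    embed' : ∀ {a} → (+∂ ∶ a) ∈ P ++ [ +∂ ∶ b ] → (+λ ∶ a) ∈ P' ++ [ +λ ∶ b ]
    embed' a∈ with ∈-++⁻ P a∈
    ... | inj₁ a∈P = ∈-++⁺ˡ (embed a∈P)
    ... | inj₂ (here refl) = ∈-++⁺ʳ P' (here refl)

  shadow-skip : ∀ {P t} → (∀ a → t ≢ (+∂ ∶ a)) → LambdaShadow P → LambdaShadow (P ++ [ t ])
  shadow-skip {P} {t} not∂ (P' , pr' , embed) = P' , pr' , embed'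
    where
    embed' : ∀ {a} → (+∂ ∶ a) ∈ P ++ [ t ] → (+λ ∶ a) ∈ P'
    embed' {a} a∈ with ∈-++⁻ P a∈
    ... | inj₁ a∈P = embed a∈P
    ... | inj₂ (here eq) = ⊥-elim (not∂ a (sym eq))

  shadow : ∀ {P} → IsProof (Valid∂ D) P → LambdaShadow P
  shadow [] = [] , [] , λ ()
  shadow (snoc {t = +∂ ∶ _} pr v) = shadow-∂ (shadow pr) v
  shadow (snoc {t = +Δ ∶ _} pr _) = shadow-skip (λ _ ()) (shadow pr)
  shadow (snoc {t = -Δ ∶ _} pr _) = shadow-skip (λ _ ()) (shadow pr)
  shadow (snoc {t = +λ ∶ _} pr _) = shadow-skip (λ _ ()) (shadow pr)

  ∂⇒λ : ∀ {P a} → IsProof (Valid∂ D) P → (+∂ ∶ a) ∈ P → Pλ D (+λ ∶ a)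
  ∂⇒λ pr a∈ with shadow pr
  ... | P' , pr' , embed = P' , pr' , embed a∈

  mustBeat : ∀ {Q r s} → IsProof (Valid∂ D) Q →
             All (λ a → (+∂ ∶ a) ∈ Q) (ante (R D s)) →
             Any (λ a → ¬ Pλ D (+λ ∶ a)) (ante (R D s)) ⊎ _≻_ D r s →
             _≻_ D r s
  mustBeat pr body (inj₁ discounted) =
    ⊥-elim (All.lookupWith (λ a∈ notλ → notλ (∂⇒λ pr a∈)) body discounted)
  mustBeat pr body (inj₂ r≻s) = r≻s

  DefeasibleSupport : List (Tagged Atom) → Literal Atom → Set
  DefeasibleSupport Q l =
    Σ (Fin (n D)) λ r → IsSD (kind (R D r)) × cons (R D r) ≡ l ×
      All (λ a → (+∂ ∶ a) ∈ Q) (ante (R D r)) ×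
      ¬ PΔ D (+Δ ∶ ∼ l) ×
      (∀ s → cons (R D s) ≡ ∼ l →
         Any (λ a → ¬ Pλ D (+λ ∶ a)) (ante (R D s)) ⊎ _≻_ D r s)

  -- Complementary literals cannot both be defeasibly supported: each
  -- supporting rule would have to beat the other, creating a cycle in >.
  noMutualSupport : ∀ {Q₁ Q₂ l} → IsProof (Valid∂ D) Q₁ → IsProof (Valid∂ D) Q₂ →
                    DefeasibleSupport Q₁ l → DefeasibleSupport Q₂ (∼ l) → ⊥
  noMutualSupport {l = l} pr₁ pr₂ (r , _ , r⊢l , body₁ , _ , defeats₁)
                                  (s , _ , s⊢∼l , body₂ , _ , defeats₂) =
    acyclic D r (r≻s TC.∷ TC.[ s≻r ])
    where
    r≻s : _≻_ D r s
    r≻s = mustBeat pr₂ body₂ (defeats₁ s s⊢∼l)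
    s≻r : _≻_ D s r
    s≻r = mustBeat pr₁ body₁ (defeats₂ r (trans r⊢l (sym (∼-involutive l))))

  -- Consistency for an arbitrary literal l: both +∂ l and +∂ ∼l can only be
  -- justified by clause (1).
  ∂-consistent : ∀ l → Consequence D (+∂ ∶ l) → Consequence D (+∂ ∶ ∼ l) →
                 PΔ D (+Δ ∶ l) × PΔ D (+Δ ∶ ∼ l)
  ∂-consistent l (_ , pr₁ , l∈) (_ , pr₂ , ∼l∈)
    with justified pr₁ l∈ | justified pr₂ ∼l∈
  ... | _ , _ , inj₁ Δl | _ , _ , inj₁ Δ∼l = Δl , Δ∼l
  ... | _ , _ , inj₁ Δl | _ , _ , inj₂ (_ , _ , _ , _ , noΔ∼∼l , _) =
    ⊥-elim (noΔ∼∼l (subst (λ m → PΔ D (+Δ ∶ m)) (sym (∼-involutive l)) Δl))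
  ... | _ , _ , inj₂ (_ , _ , _ , _ , noΔ∼l , _) | _ , _ , inj₁ Δ∼l = ⊥-elim (noΔ∼l Δ∼l)
  ... | _ , q₁ , inj₂ support₁ | _ , q₂ , inj₂ support₂ =
    ⊥-elim (noMutualSupport q₁ q₂ support₁ support₂)

corollaryA1 : (Atom : Set) (D : Theory Atom) (q : Atom) →
              Consequence D (+∂ ∶ ⁺ q) → Consequence D (+∂ ∶ ⁻ q) →
              Consequence D (+Δ ∶ ⁺ q) × Consequence D (+Δ ∶ ⁻ q)
corollaryA1 _ D q ∂q ∂¬q =
  map (Δ⇒consequence D) (Δ⇒consequence D) (∂-consistent D (⁺ q) ∂q ∂¬q)
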